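{- For $i,j\ge 0$ let $c^{(2)}_{i,j}$ be the number of standard paths whose final composition has exactly $i$ parts equal to $1$, exactly $j$ parts equal to $2$, and no other parts. Then for all $n\ge 0$: \[ c^{(2)}_{0,n}=\frac{(2n)!}{(n+1)!},\qquad c^{(2)}_{1,n}=c^{(2)}_{0,n+1}=\frac{(2(n+1))!}{(n+2)!}, \] \[ c^{(2)}_{2,n}=\tfrac12 c^{(2)}_{0,n+2}-c^{(2)}_{0,n+1}=\frac{1}{16}\cdot\frac{(2n^2+6n+3)\,2^{2n+6}\,\Gamma(n+3/2)}{(n+3)\sqrt{\pi}\,(n+2)}. \]
   Context: A composition is a finite sequence $P=(p_1,\dots,p_k)$ of positive integers (its parts); the empty composition $()$ is allowed, and the weight of $P$ is $p_1+\cdots+p_k$. $Q$ covers $P=(p_1,\dots,p_k)$ if $Q$ is one of $(1,p_1,\dots,p_k)$, $(p_1,\dots,p_k,1)$, or $(p_1,\dots,p_i+1,\dots,p_k)$ for some $1\le i\le k$. A standard path of length $n$ is a sequence $(P_0,P_1,\dots,P_n)$ of compositions with $P_i$ of weight $i$ and $P_{i+1}$ covering $P_i$ for each $i$; its final composition is $P_n$. Standard paths are distinct iff they differ as sequences of compositions. -}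

module Defs where

open import Data.Nat using (ℕ; zero; suc; _+_; _*_; _≟_)
open import Data.List using (List; []; _∷_; [_]; _++_; map; concatMap; filter; length; deduplicate)
open import Data.List.Properties using (≡-dec)
open import Data.List.Relation.Unary.All using (All; all?)
open import Data.Product using (_×_)
open import Data.Sum using (_⊎_)
open import Relation.Binary.PropositionalEquality using (_≡_)
open import Relation.Nullary using (Dec)
open import Relation.Nullary.Decidable using (_×-dec_; _⊎-dec_)

-- A composition: a finite list of positive integers (positivity is
-- automatically maintained by the covering operations starting from []).
Composition : Set
Composition = List ℕ

weight : Composition → ℕ
weight [] = 0
weight (p ∷ ps) = p + weight ps

bumps : Composition → List Composition
bumps [] = []
bumps (p ∷ ps) = (suc p ∷ ps) ∷ map (p ∷_) (bumps ps)

coverList : Composition → List Composition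
coverList P = (1 ∷ P) ∷ (P ++ [ 1 ]) ∷ bumps P

covers : Composition → List Composition
covers P = deduplicate (≡-dec _≟_) (coverList P)

-- A standard path (P_0, ..., P_n) is represented as the list [P_0, ..., P_n].
Path : Set
Path = List Composition

final : Path → Composition
final [] = []
final (P ∷ []) = P
final (_ ∷ Ps) = final Ps

-- list of all standard paths of length n, each occurring exactly once
standardPaths : ℕ → List Path
standardPaths zero = [ [ [] ] ]
standardPaths (suc n) =
  concatMap (λ p → map (λ Q → p ++ [ Q ]) (covers (final p))) (standardPaths n)

countParts : ℕ → Composition → ℕ
countParts k P = length (filter (_≟ k) P)

HasShape12 : ℕ → ℕ → Composition → Set
HasShape12 i j P = (countParts 1 P ≡ i × countParts 2 P ≡ j) × All (λ p → p ≡ 1 ⊎ p ≡ 2) P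

hasShape12? : ∀ i j P → Dec (HasShape12 i j P)
hasShape12? i j P = ((countParts 1 P ≟ i) ×-dec (countParts 2 P ≟ j)) ×-dec all? (λ p → (p ≟ 1) ⊎-dec (p ≟ 2)) P

-- c^{(2)}_{i,j}: such a final composition has weight i + 2j, so the
-- relevant standard paths are exactly those of length i + 2 * j.
c2 : ℕ → ℕ → ℕ
c2 i j = length (filter (λ p → hasShape12? i j (final p)) (standardPaths (i + 2 * j)))

-- Parts never decrease along a path, so only compositions with all parts in {1, 2} matter,
-- and for those the number of ways to continue depends only on the shape (a, b) = (number of
-- 1s, number of 2s): the covers of such a composition P are 1P and P1 (equal exactly when
-- b = 0), the a compositions of shape (a - 1, b + 1) obtained by raising a 1, and compositions
-- with a part 3, which are dead ends.  Summing over paths backwards from the final composition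
-- turns c2 i j into the number of (i + 2j)-step continuations of the shape (0, 0) that end at
-- shape (i, j), a quantity given by a linear recursion in the shape.  Towards the shape (0, n)
-- this recursion has a closed form: from (a, b) with b > 0 there are k!/r! continuations, where
-- r = n - a - b is the number of 1s still to be inserted, and a similar formula holds for b = 0;
-- this gives c2 0 n.  The other identities come from the last step: the shape (0, n + 1) is
-- reached only from (1, n), and (1, n + 1) in two ways from (0, n + 1) and in two from (2, n).
module Submission where

open import Defs
open import Data.Nat using (ℕ; zero; suc; pred; _+_; _*_; _!; _<_; _≟_; s≤s; z<s)
open import Data.Nat.Properties
open import Data.Nat.ListAction using (sum)
open import Data.Nat.ListAction.Properties using (sum-++)
open import Data.Nat.Tactic.RingSolver using (solve-∀)
open import Data.Bool using (true; false; if_then_else_)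
open import Data.List using (List; []; _∷_; [_]; _++_; map; concatMap; filter; length; deduplicate)
open import Data.List.Properties using (≡-dec; map-++; map-∘; map-cong; map-cong-local; length-++; filter-all; filter-accept; filter-reject; ∷-injectiveˡ; ∷-injectiveʳ)
open import Data.List.Relation.Unary.All using (All; []; _∷_; all?)
import Data.List.Relation.Unary.All as All
import Data.List.Relation.Unary.All.Properties as All
open import Data.List.Relation.Unary.Unique.Propositional using (Unique; []; _∷_)
import Data.List.Relation.Unary.Unique.Propositional.Properties as Unique
open import Data.Product using (_×_; _,_)
open import Data.Sum using (_⊎_; inj₁; inj₂)
open import Data.Empty using (⊥-elim)
open import Function using (_∘_)
open import Algebra.Properties.CommutativeSemigroup *-commutativeSemigroup using (x∙yz≈y∙xz)
open import Relation.Binary.PropositionalEquality hiding ([_])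
open import Relation.Binary.Definitions using (DecidableEquality)
open import Relation.Nullary using (Dec; yes; no; ¬_; does; ¬?)
open import Relation.Nullary.Decidable using (_⊎-dec_)

open ≡-Reasoning

byShape : (ℕ → ℕ → ℕ) → Composition → ℕ
byShape G []                      = G 0 0
byShape G (1 ∷ P)                 = byShape (λ a b → G (suc a) b) P
byShape G (2 ∷ P)                 = byShape (λ a b → G a (suc b)) P
byShape G (0 ∷ _)                 = 0
byShape G (suc (suc (suc _)) ∷ _) = 0

byShape-+ : ∀ G H P → byShape (λ a b → G a b + H a b) P ≡ byShape G P + byShape H P
byShape-+ G H []                      = refl
byShape-+ G H (1 ∷ P)                 = byShape-+ _ _ P
byShape-+ G H (2 ∷ P)                 = byShape-+ _ _ P
byShape-+ G H (0 ∷ _)                 = refl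
byShape-+ G H (suc (suc (suc _)) ∷ _) = refl

byShape-* : ∀ c G P → byShape (λ a b → c * G a b) P ≡ c * byShape G P
byShape-* c G []                      = refl
byShape-* c G (1 ∷ P)                 = byShape-* c _ P
byShape-* c G (2 ∷ P)                 = byShape-* c _ P
byShape-* c G (0 ∷ _)                 = sym (*-zeroʳ c)
byShape-* c G (suc (suc (suc _)) ∷ _) = sym (*-zeroʳ c)

byShape-cong : ∀ {G H} → (∀ a b → G a b ≡ H a b) → ∀ P → byShape G P ≡ byShape H P
byShape-cong G≗H []                      = G≗H 0 0
byShape-cong G≗H (1 ∷ P)                 = byShape-cong (λ a b → G≗H (suc a) b) P
byShape-cong G≗H (2 ∷ P)                 = byShape-cong (λ a b → G≗H a (suc b)) P
byShape-cong G≗H (0 ∷ _)                 = refl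
byShape-cong G≗H (suc (suc (suc _)) ∷ _) = refl

byShape-∷ʳ : ∀ G P → byShape G (P ++ [ 1 ]) ≡ byShape G (1 ∷ P)
byShape-∷ʳ G []                      = refl
byShape-∷ʳ G (1 ∷ P)                 = byShape-∷ʳ _ P
byShape-∷ʳ G (2 ∷ P)                 = byShape-∷ʳ _ P
byShape-∷ʳ G (0 ∷ _)                 = refl
byShape-∷ʳ G (suc (suc (suc _)) ∷ _) = refl

byShape-ends≡ : ∀ G P → 1 ∷ P ≡ P ++ [ 1 ] → byShape G P ≡ G (length P) 0
byShape-ends≡ G []      _    = refl
byShape-ends≡ G (p ∷ P) ends with ∷-injectiveˡ ends
... | refl = byShape-ends≡ (λ a b → G (suc a) b) P (∷-injectiveʳ ends)

insertions : ℕ → ℕ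
insertions zero    = 1
insertions (suc _) = 2

byShape-ends≢ : ∀ G P → ¬ (1 ∷ P ≡ P ++ [ 1 ]) →
  byShape (λ a b → insertions b * G a b) P ≡ 2 * byShape G P
byShape-ends≢ G []                      ends≢ = ⊥-elim (ends≢ refl)
byShape-ends≢ G (1 ∷ P)                 ends≢ = byShape-ends≢ _ P (ends≢ ∘ cong (1 ∷_))
byShape-ends≢ G (2 ∷ P)                 _     = byShape-* 2 _ P
byShape-ends≢ G (0 ∷ _)                 _     = refl
byShape-ends≢ G (suc (suc (suc _)) ∷ _) _     = refl

OnesAndTwos : Composition → Set
OnesAndTwos = All (λ p → p ≡ 1 ⊎ p ≡ 2)

byShape-onesAndTwos : ∀ G P → OnesAndTwos P → byShape G P ≡ G (countParts 1 P) (countParts 2 P)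
byShape-onesAndTwos G []      []                      = refl
byShape-onesAndTwos G (_ ∷ P) (inj₁ refl ∷ ones-twos) = byShape-onesAndTwos _ P ones-twos
byShape-onesAndTwos G (_ ∷ P) (inj₂ refl ∷ ones-twos) = byShape-onesAndTwos _ P ones-twos

byShape-¬onesAndTwos : ∀ G P → ¬ OnesAndTwos P → byShape G P ≡ 0
byShape-¬onesAndTwos G []                      ¬ones-twos = ⊥-elim (¬ones-twos [])
byShape-¬onesAndTwos G (1 ∷ P)                 ¬ones-twos = byShape-¬onesAndTwos _ P (¬ones-twos ∘ (inj₁ refl ∷_))
byShape-¬onesAndTwos G (2 ∷ P)                 ¬ones-twos = byShape-¬onesAndTwos _ P (¬ones-twos ∘ (inj₂ refl ∷_))
byShape-¬onesAndTwos G (0 ∷ _)                 _          = refl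
byShape-¬onesAndTwos G (suc (suc (suc _)) ∷ _) _          = refl

_≟ᶜ_ : DecidableEquality Composition
_≟ᶜ_ = ≡-dec _≟_

deduplicate-unique : ∀ {A : Set} (_≟ᴬ_ : DecidableEquality A) {xs} → Unique xs → deduplicate _≟ᴬ_ xs ≡ xs
deduplicate-unique _≟ᴬ_ []                     = refl
deduplicate-unique _≟ᴬ_ {x ∷ xs} (x∉xs ∷ uniq) = cong (x ∷_) (begin
  filter (¬? ∘ (x ≟ᴬ_)) (deduplicate _≟ᴬ_ xs) ≡⟨ cong (filter (¬? ∘ (x ≟ᴬ_))) (deduplicate-unique _≟ᴬ_ uniq) ⟩
  filter (¬? ∘ (x ≟ᴬ_)) xs                    ≡⟨ filter-all (¬? ∘ (x ≟ᴬ_)) x∉xs ⟩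
  xs                                          ∎)

bumps-unique : ∀ P → Unique (bumps P)
bumps-unique []      = []
bumps-unique (p ∷ P) = head∉tail (bumps P) ∷ Unique.map⁺ ∷-injectiveʳ (bumps-unique P)
  where
  head∉tail : ∀ Qs → All (λ Q → ¬ suc p ∷ P ≡ Q) (map (p ∷_) Qs)
  head∉tail []       = []
  head∉tail (_ ∷ Qs) = (1+n≢n ∘ ∷-injectiveˡ) ∷ head∉tail Qs

bumps-length : ∀ P → All (λ Q → length Q ≡ length P) (bumps P)
bumps-length []      = []
bumps-length (p ∷ P) = refl ∷ All.map⁺ (All.map (cong suc) (bumps-length P))

filter-≢-bumps : ∀ Q P → length Q ≡ suc (length P) → filter (¬? ∘ (Q ≟ᶜ_)) (bumps P) ≡ bumps P
filter-≢-bumps Q P |Q| = filter-all (¬? ∘ (Q ≟ᶜ_)) (All.map Q≢ (bumps-length P))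
  where
  Q≢ : ∀ {R} → length R ≡ length P → ¬ Q ≡ R
  Q≢ |R| refl = 1+n≢n (trans (sym |Q|) |R|)

covers-≡ : ∀ P → covers P ≡ (1 ∷ P) ∷ filter (¬? ∘ ((1 ∷ P) ≟ᶜ_)) ((P ++ [ 1 ]) ∷ bumps P)
covers-≡ P = cong (λ Qs → (1 ∷ P) ∷ filter (¬? ∘ ((1 ∷ P) ≟ᶜ_)) ((P ++ [ 1 ]) ∷ Qs)) (begin
  filter (¬? ∘ ((P ++ [ 1 ]) ≟ᶜ_)) (deduplicate _≟ᶜ_ (bumps P))
    ≡⟨ cong (filter (¬? ∘ ((P ++ [ 1 ]) ≟ᶜ_))) (deduplicate-unique _≟ᶜ_ (bumps-unique P)) ⟩
  filter (¬? ∘ ((P ++ [ 1 ]) ≟ᶜ_)) (bumps P)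
    ≡⟨ filter-≢-bumps (P ++ [ 1 ]) P (trans (length-++ P) (+-comm (length P) 1)) ⟩
  bumps P ∎)

covers-ends≡ : ∀ P → 1 ∷ P ≡ P ++ [ 1 ] → covers P ≡ (1 ∷ P) ∷ bumps P
covers-ends≡ P ends = trans (covers-≡ P) (cong ((1 ∷ P) ∷_) (begin
  filter (¬? ∘ ((1 ∷ P) ≟ᶜ_)) ((P ++ [ 1 ]) ∷ bumps P) ≡⟨ filter-reject (¬? ∘ ((1 ∷ P) ≟ᶜ_)) (λ ≢ → ≢ ends) ⟩
  filter (¬? ∘ ((1 ∷ P) ≟ᶜ_)) (bumps P)                ≡⟨ filter-≢-bumps (1 ∷ P) P refl ⟩
  bumps P                                              ∎))

covers-ends≢ : ∀ P → ¬ (1 ∷ P ≡ P ++ [ 1 ]) → covers P ≡ (1 ∷ P) ∷ (P ++ [ 1 ]) ∷ bumps P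
covers-ends≢ P ends≢ = trans (covers-≡ P) (cong ((1 ∷ P) ∷_) (begin
  filter (¬? ∘ ((1 ∷ P) ≟ᶜ_)) ((P ++ [ 1 ]) ∷ bumps P) ≡⟨ filter-accept (¬? ∘ ((1 ∷ P) ≟ᶜ_)) ends≢ ⟩
  (P ++ [ 1 ]) ∷ filter (¬? ∘ ((1 ∷ P) ≟ᶜ_)) (bumps P) ≡⟨ cong ((P ++ [ 1 ]) ∷_) (filter-≢-bumps (1 ∷ P) P refl) ⟩
  (P ++ [ 1 ]) ∷ bumps P                               ∎))

Positive : Composition → Set
Positive = All (0 <_)

bumps-positive : ∀ {P} → Positive P → All Positive (bumps P)
bumps-positive []          = []
bumps-positive (p>0 ∷ P>0) = (z<s ∷ P>0) ∷ All.map⁺ (All.map (p>0 ∷_) (bumps-positive P>0))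

covers-positive : ∀ {P} → Positive P → All Positive (covers P)
covers-positive P>0 =
  All.deduplicate⁺ _≟ᶜ_ ((z<s ∷ P>0) ∷ All.++⁺ P>0 (z<s ∷ []) ∷ bumps-positive P>0)

sum-byShape-bumps : ∀ G P → Positive P →
  sum (map (byShape G) (bumps P)) ≡ byShape (λ a b → a * G (pred a) (suc b)) P
sum-byShape-bumps G []                      []       = refl
sum-byShape-bumps G (1 ∷ P)                 (_ ∷ P>0) = begin
  byShape G (2 ∷ P) + sum (map (byShape G) (map (1 ∷_) (bumps P)))
    ≡⟨ cong (byShape G (2 ∷ P) +_) (cong sum (sym (map-∘ (bumps P)))) ⟩
  byShape G (2 ∷ P) + sum (map (byShape G ∘ (1 ∷_)) (bumps P))
    ≡⟨ cong (byShape G (2 ∷ P) +_) (sum-byShape-bumps (λ a b → G (suc a) b) P P>0) ⟩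
  byShape (λ a b → G a (suc b)) P + byShape (λ a b → a * G (suc (pred a)) (suc b)) P
    ≡⟨ byShape-+ _ _ P ⟨
  byShape (λ a b → G a (suc b) + a * G (suc (pred a)) (suc b)) P
    ≡⟨ byShape-cong (λ a b → a*suc-pred a (λ a → G a (suc b))) P ⟩
  byShape (λ a b → suc a * G a (suc b)) P ∎
  where
  a*suc-pred : ∀ a (f : ℕ → ℕ) → f a + a * f (suc (pred a)) ≡ suc a * f a
  a*suc-pred zero    f = refl
  a*suc-pred (suc a) f = refl
sum-byShape-bumps G (2 ∷ P)                 (_ ∷ P>0) = begin
  byShape G (3 ∷ P) + sum (map (byShape G) (map (2 ∷_) (bumps P)))
    ≡⟨ cong sum (sym (map-∘ (bumps P))) ⟩
  sum (map (byShape G ∘ (2 ∷_)) (bumps P))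
    ≡⟨ sum-byShape-bumps (λ a b → G a (suc b)) P P>0 ⟩
  byShape (λ a b → a * G (pred a) (suc (suc b))) P ∎
sum-byShape-bumps G (suc (suc (suc p)) ∷ P) (_ ∷ _)   = begin
  sum (map (byShape G) (map (suc (suc (suc p)) ∷_) (bumps P))) ≡⟨ cong sum (sym (map-∘ (bumps P))) ⟩
  sum (map (λ _ → 0) (bumps P))                                 ≡⟨ sum-zeros (bumps P) ⟩
  0                                                             ∎
  where
  sum-zeros : ∀ (xs : List Composition) → sum (map (λ _ → 0) xs) ≡ 0
  sum-zeros []       = refl
  sum-zeros (_ ∷ xs) = sum-zeros xs

extend : (ℕ → ℕ → ℕ) → ℕ → ℕ → ℕ
extend G a b = insertions b * G (suc a) b + a * G (pred a) (suc b)

sum-byShape-covers : ∀ G P → Positive P → sum (map (byShape G) (covers P)) ≡ byShape (extend G) P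
sum-byShape-covers G P P>0 = byEnds ((1 ∷ P) ≟ᶜ (P ++ [ 1 ]))
  where
  B = byShape (λ a b → a * G (pred a) (suc b)) P
  m = length P

  x+[x+y]≡2*x+y : ∀ x y → x + (x + y) ≡ 2 * x + y
  x+[x+y]≡2*x+y = solve-∀

  byEnds : Dec (1 ∷ P ≡ P ++ [ 1 ]) → sum (map (byShape G) (covers P)) ≡ byShape (extend G) P
  byEnds (yes ends) = begin
    sum (map (byShape G) (covers P))                    ≡⟨ cong (sum ∘ map (byShape G)) (covers-ends≡ P ends) ⟩
    byShape G (1 ∷ P) + sum (map (byShape G) (bumps P)) ≡⟨ cong₂ _+_ (byShape-ends≡ _ P ends) bumpsSum ⟩
    G (suc m) 0 + m * G (pred m) 1                      ≡⟨ cong (_+ m * G (pred m) 1) (*-identityˡ (G (suc m) 0)) ⟨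
    extend G m 0                                        ≡⟨ byShape-ends≡ (extend G) P ends ⟨
    byShape (extend G) P                                ∎
    where
    bumpsSum : sum (map (byShape G) (bumps P)) ≡ m * G (pred m) 1
    bumpsSum = trans (sum-byShape-bumps G P P>0) (byShape-ends≡ _ P ends)
  byEnds (no ends≢) = begin
    sum (map (byShape G) (covers P))
      ≡⟨ cong (sum ∘ map (byShape G)) (covers-ends≢ P ends≢) ⟩
    byShape G (1 ∷ P) + (byShape G (P ++ [ 1 ]) + sum (map (byShape G) (bumps P)))
      ≡⟨ cong₂ (λ x y → byShape G (1 ∷ P) + (x + y)) (byShape-∷ʳ G P) (sum-byShape-bumps G P P>0) ⟩
    byShape G (1 ∷ P) + (byShape G (1 ∷ P) + B)
      ≡⟨ x+[x+y]≡2*x+y (byShape G (1 ∷ P)) B ⟩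
    2 * byShape G (1 ∷ P) + B
      ≡⟨ cong (_+ B) (byShape-ends≢ _ P ends≢) ⟨
    byShape (λ a b → insertions b * G (suc a) b) P + B
      ≡⟨ byShape-+ _ _ P ⟨
    byShape (extend G) P ∎

final-∷ʳ : ∀ (p : Path) Q → final (p ++ [ Q ]) ≡ Q
final-∷ʳ []          Q = refl
final-∷ʳ (_ ∷ [])    Q = refl
final-∷ʳ (_ ∷ P ∷ p) Q = final-∷ʳ (P ∷ p) Q

sum-map-concatMap : ∀ {A B : Set} (f : B → ℕ) (g : A → List B) xs →
  sum (map f (concatMap g xs)) ≡ sum (map (sum ∘ map f ∘ g) xs)
sum-map-concatMap f g []       = refl
sum-map-concatMap f g (x ∷ xs) = begin
  sum (map f (g x ++ concatMap g xs))                ≡⟨ cong sum (map-++ f (g x) _) ⟩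
  sum (map f (g x) ++ map f (concatMap g xs))        ≡⟨ sum-++ (map f (g x)) _ ⟩
  sum (map f (g x)) + sum (map f (concatMap g xs))   ≡⟨ cong (sum (map f (g x)) +_) (sum-map-concatMap f g xs) ⟩
  sum (map f (g x)) + sum (map (sum ∘ map f ∘ g) xs) ∎

sum-final-standardPaths-suc : ∀ (f : Composition → ℕ) n →
  sum (map (f ∘ final) (standardPaths (suc n))) ≡ sum (map (sum ∘ map f ∘ covers ∘ final) (standardPaths n))
sum-final-standardPaths-suc f n = begin
  sum (map (f ∘ final) (concatMap extensions (standardPaths n)))
    ≡⟨ sum-map-concatMap (f ∘ final) extensions (standardPaths n) ⟩
  sum (map (sum ∘ map (f ∘ final) ∘ extensions) (standardPaths n))
    ≡⟨ cong sum (map-cong (cong sum ∘ final-extensions) (standardPaths n)) ⟩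
  sum (map (sum ∘ map f ∘ covers ∘ final) (standardPaths n)) ∎
  where
  extensions : Path → List Path
  extensions p = map (λ Q → p ++ [ Q ]) (covers (final p))
  final-extensions : ∀ p → map (f ∘ final) (extensions p) ≡ map f (covers (final p))
  final-extensions p = trans (sym (map-∘ (covers (final p)))) (map-cong (cong f ∘ final-∷ʳ p) _)

standardPaths-positive : ∀ n → All (Positive ∘ final) (standardPaths n)
standardPaths-positive zero    = [] ∷ []
standardPaths-positive (suc n) =
  All.concat⁺ (All.map⁺ (All.map (λ {p} → extensions-positive p) (standardPaths-positive n)))
  where
  extensions-positive : ∀ p → Positive (final p) → All (Positive ∘ final) (map (λ Q → p ++ [ Q ]) (covers (final p)))
  extensions-positive p p>0 = All.map⁺ (All.map (λ {Q} → subst Positive (sym (final-∷ʳ p Q))) (covers-positive p>0))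

completions : ℕ → (ℕ → ℕ → ℕ) → ℕ → ℕ → ℕ
completions zero    G = G
completions (suc k) G = extend (completions k G)

extend-cong : ∀ {G H} → (∀ a b → G a b ≡ H a b) → ∀ a b → extend G a b ≡ extend H a b
extend-cong G≗H a b = cong₂ (λ x y → insertions b * x + a * y) (G≗H (suc a) b) (G≗H (pred a) (suc b))

completions-cong : ∀ {G H} → (∀ a b → G a b ≡ H a b) → ∀ k a b → completions k G a b ≡ completions k H a b
completions-cong G≗H zero    = G≗H
completions-cong G≗H (suc k) = extend-cong (completions-cong G≗H k)

completions-extend : ∀ k G a b → completions (suc k) G a b ≡ completions k (extend G) a b
completions-extend zero    G = λ _ _ → refl
completions-extend (suc k) G = extend-cong (completions-extend k G)

sum-byShape-standardPaths : ∀ G n → sum (map (byShape G ∘ final) (standardPaths n)) ≡ completions n G 0 0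
sum-byShape-standardPaths G zero    = +-identityʳ (G 0 0)
sum-byShape-standardPaths G (suc n) = begin
  sum (map (byShape G ∘ final) (standardPaths (suc n)))
    ≡⟨ sum-final-standardPaths-suc (byShape G) n ⟩
  sum (map (sum ∘ map (byShape G) ∘ covers ∘ final) (standardPaths n))
    ≡⟨ cong sum (map-cong-local (All.map (sum-byShape-covers G _) (standardPaths-positive n))) ⟩
  sum (map (byShape (extend G) ∘ final) (standardPaths n))
    ≡⟨ sum-byShape-standardPaths (extend G) n ⟩
  completions n (extend G) 0 0
    ≡⟨ completions-extend n G 0 0 ⟨
  completions (suc n) G 0 0 ∎

δ : ℕ → ℕ → ℕ
δ zero    zero    = 1
δ zero    (suc _) = 0
δ (suc _) zero    = 0
δ (suc m) (suc n) = δ m n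

δ-≡ : ∀ {m n} → m ≡ n → δ m n ≡ 1
δ-≡ {zero}  refl = refl
δ-≡ {suc m} refl = δ-≡ {m} refl

δ-≢ : ∀ {m n} → m ≢ n → δ m n ≡ 0
δ-≢ {zero}  {zero}  m≢n = ⊥-elim (m≢n refl)
δ-≢ {zero}  {suc n} _   = refl
δ-≢ {suc m} {zero}  _   = refl
δ-≢ {suc m} {suc n} m≢n = δ-≢ (m≢n ∘ cong suc)

atShape : ℕ → ℕ → ℕ → ℕ → ℕ
atShape i j a b = δ a i * δ b j

byShape-atShape : ∀ i j P → byShape (atShape i j) P ≡ (if does (hasShape12? i j P) then 1 else 0)
byShape-atShape i j P = byShape≡indicator (hasShape12? i j P)
  where
  a = countParts 1 P
  b = countParts 2 P

  wrongCounts : ¬ HasShape12 i j P → OnesAndTwos P → Dec (a ≡ i) → Dec (b ≡ j) → atShape i j a b ≡ 0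
  wrongCounts _      _         (no a≢i) _        = cong (_* δ b j) (δ-≢ a≢i)
  wrongCounts _      _         (yes _)  (no b≢j) = trans (cong (δ a i *_) (δ-≢ b≢j)) (*-zeroʳ (δ a i))
  wrongCounts ¬shape ones-twos (yes a≡i) (yes b≡j) = ⊥-elim (¬shape ((a≡i , b≡j) , ones-twos))

  byShape≡0 : ¬ HasShape12 i j P → Dec (OnesAndTwos P) → byShape (atShape i j) P ≡ 0
  byShape≡0 _      (no ¬ones-twos) = byShape-¬onesAndTwos _ P ¬ones-twos
  byShape≡0 ¬shape (yes ones-twos) =
    trans (byShape-onesAndTwos _ P ones-twos) (wrongCounts ¬shape ones-twos (a ≟ i) (b ≟ j))

  byShape≡indicator : (shape? : Dec (HasShape12 i j P)) → byShape (atShape i j) P ≡ (if does shape? then 1 else 0)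
  byShape≡indicator (yes ((a≡i , b≡j) , ones-twos)) =
    trans (byShape-onesAndTwos _ P ones-twos) (cong₂ _*_ (δ-≡ a≡i) (δ-≡ b≡j))
  byShape≡indicator (no ¬shape) = byShape≡0 ¬shape (all? (λ p → (p ≟ 1) ⊎-dec (p ≟ 2)) P)

length-filter≡sum : ∀ {A : Set} {P : A → Set} (P? : ∀ x → Dec (P x)) xs →
  length (filter P? xs) ≡ sum (map (λ x → if does (P? x) then 1 else 0) xs)
length-filter≡sum P? []       = refl
length-filter≡sum P? (x ∷ xs) with does (P? x)
... | true  = cong suc (length-filter≡sum P? xs)
... | false = length-filter≡sum P? xs

c2≡completions : ∀ i j → c2 i j ≡ completions (i + 2 * j) (atShape i j) 0 0
c2≡completions i j = begin
  c2 i j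
    ≡⟨ length-filter≡sum (λ p → hasShape12? i j (final p)) (standardPaths (i + 2 * j)) ⟩
  sum (map (λ p → if does (hasShape12? i j (final p)) then 1 else 0) (standardPaths (i + 2 * j)))
    ≡⟨ cong sum (map-cong (sym ∘ byShape-atShape i j ∘ final) (standardPaths (i + 2 * j))) ⟩
  sum (map (byShape (atShape i j) ∘ final) (standardPaths (i + 2 * j)))
    ≡⟨ sum-byShape-standardPaths (atShape i j) (i + 2 * j) ⟩
  completions (i + 2 * j) (atShape i j) 0 0 ∎

extend-linear : ∀ c d G H a b →
  extend (λ x y → c * G x y + d * H x y) a b ≡ c * extend G a b + d * extend H a b
extend-linear c d G H a b = distribute (insertions b) a c d (G (suc a) b) (H (suc a) b) (G (pred a) (suc b)) (H (pred a) (suc b))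
  where
  distribute : ∀ i a c d x y x′ y′ →
    i * (c * x + d * y) + a * (c * x′ + d * y′) ≡ c * (i * x + a * x′) + d * (i * y + a * y′)
  distribute = solve-∀

completions-linear : ∀ c d G H k a b →
  completions k (λ x y → c * G x y + d * H x y) a b ≡ c * completions k G a b + d * completions k H a b
completions-linear c d G H zero    a b = refl
completions-linear c d G H (suc k) a b =
  trans (extend-cong (completions-linear c d G H k) a b) (extend-linear c d (completions k G) (completions k H) a b)

extend-atShape-0 : ∀ n a b → extend (atShape 0 (suc n)) a b ≡ atShape 1 n a b
extend-atShape-0 n zero                zero    = refl
extend-atShape-0 n zero                (suc b) = refl
extend-atShape-0 n (suc zero)          zero    = +-identityʳ (1 * δ 0 n)
extend-atShape-0 n (suc zero)          (suc b) = +-identityʳ (1 * δ (suc b) n)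
extend-atShape-0 n (suc (suc a))       zero    = *-zeroʳ a
extend-atShape-0 n (suc (suc a))       (suc b) = *-zeroʳ a

extend-atShape-1 : ∀ n a b → extend (atShape 1 (suc n)) a b ≡ 2 * atShape 0 (suc n) a b + 2 * atShape 2 n a b
extend-atShape-1 n zero                zero    = refl
extend-atShape-1 n zero                (suc b) = refl
extend-atShape-1 n (suc zero)          zero    = refl
extend-atShape-1 n (suc zero)          (suc b) = refl
extend-atShape-1 n (suc (suc zero))    zero    = refl
extend-atShape-1 n (suc (suc zero))    (suc b) = refl
extend-atShape-1 n (suc (suc (suc a))) zero    = *-zeroʳ a
extend-atShape-1 n (suc (suc (suc a))) (suc b) = *-zeroʳ a

m+[1+n]+[1+n]≡2+m+n+n : ∀ m n → m + suc n + suc n ≡ 2 + m + n + n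
m+[1+n]+[1+n]≡2+m+n+n = solve-∀

toAllTwos-unreachable : ∀ n k a b → n < a + b → completions k (atShape 0 n) a b ≡ 0
toAllTwos-unreachable n zero    zero    b n<b = cong (_+ 0) (δ-≢ (>⇒≢ n<b))
toAllTwos-unreachable n zero    (suc a) b _   = refl
toAllTwos-unreachable n (suc k) a       b n<a+b = begin
  insertions b * completions k (atShape 0 n) (suc a) b + a * completions k (atShape 0 n) (pred a) (suc b)
    ≡⟨ cong₂ _+_ (cong (insertions b *_) (toAllTwos-unreachable n k (suc a) b (m<n⇒m<1+n n<a+b))) (conversion a n<a+b) ⟩
  insertions b * 0 + 0
    ≡⟨ cong (_+ 0) (*-zeroʳ (insertions b)) ⟩
  0 ∎
  where
  conversion : ∀ a → n < a + b → a * completions k (atShape 0 n) (pred a) (suc b) ≡ 0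
  conversion zero    _      = refl
  conversion (suc a) n<a+b =
    trans (cong (suc a *_) (toAllTwos-unreachable n k a (suc b) (subst (n <_) (sym (+-suc a b)) n<a+b))) (*-zeroʳ (suc a))

-- r is the number of 1s still to be inserted; every step inserts a 1 or raises a 1 to a 2.
toAllTwos-withTwo : ∀ n k a b r → a + r + r ≡ k → a + suc b + r ≡ n →
  completions k (atShape 0 n) a (suc b) * r ! ≡ k !
toAllTwos-withTwo n zero zero    b zero    _  n≡ = cong (λ x → 1 * x * 1) (δ-≡ (trans (sym (+-identityʳ (suc b))) n≡))
toAllTwos-withTwo n zero (suc a) b r       ()
toAllTwos-withTwo n zero zero    b (suc r) ()
toAllTwos-withTwo n (suc k) a b r k≡ n≡ = begin
  (2 * X + a * Y) * r !         ≡⟨ distribute X Y a (r !) ⟩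
  2 * (X * r !) + a * (Y * r !) ≡⟨ cong₂ (λ x y → 2 * x + y) (insertion r k≡ n≡) (conversion a k≡ n≡) ⟩
  2 * (r * k !) + a * k !       ≡⟨ collect r a (k !) ⟩
  (a + r + r) * k !             ≡⟨ cong (_* k !) k≡ ⟩
  suc k * k !                   ∎
  where
  X = completions k (atShape 0 n) (suc a) (suc b)
  Y = completions k (atShape 0 n) (pred a) (suc (suc b))
  distribute : ∀ x y a f → (2 * x + a * y) * f ≡ 2 * (x * f) + a * (y * f)
  distribute = solve-∀
  collect : ∀ r a f → 2 * (r * f) + a * f ≡ (a + r + r) * f
  collect = solve-∀
  insertion : ∀ r → a + r + r ≡ suc k → a + suc b + r ≡ n → X * r ! ≡ r * k !
  insertion zero    _  n≡ =
    cong (_* 1) (toAllTwos-unreachable n k (suc a) (suc b) (s≤s (≤-reflexive (trans (sym n≡) (+-identityʳ _)))))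
  insertion (suc r) k≡ n≡ = begin
    X * (suc r * r !) ≡⟨ x∙yz≈y∙xz X (suc r) (r !) ⟩
    suc r * (X * r !) ≡⟨ cong (suc r *_) (toAllTwos-withTwo n k (suc a) b r k≡′ n≡′) ⟩
    suc r * k !       ∎
    where
    k≡′ : suc a + r + r ≡ k
    k≡′ = suc-injective (trans (sym (m+[1+n]+[1+n]≡2+m+n+n a r)) k≡)
    n≡′ : suc a + suc b + r ≡ n
    n≡′ = trans (sym (+-suc (a + suc b) r)) n≡
  conversion : ∀ a → a + r + r ≡ suc k → a + suc b + r ≡ n →
    a * (completions k (atShape 0 n) (pred a) (suc (suc b)) * r !) ≡ a * k !
  conversion zero    _  _  = refl
  conversion (suc a) k≡ n≡ =
    cong (suc a *_) (toAllTwos-withTwo n k a (suc b) r (suc-injective k≡) (trans (cong (_+ r) (+-suc a (suc b))) n≡))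

toAllTwos-allOnes : ∀ n k a s → a + s + s ≡ k → a + s ≡ n →
  completions k (atShape 0 n) a 0 * s ! * suc n ≡ k ! * suc a
toAllTwos-allOnes n zero    zero    zero    _  refl = refl
toAllTwos-allOnes n zero    (suc a) s       ()
toAllTwos-allOnes n zero    zero    (suc s) ()
toAllTwos-allOnes n (suc k) a       s       k≡ n≡ = begin
  (1 * X + a * Y) * s ! * suc n                 ≡⟨ distribute X Y a (s !) (suc n) ⟩
  X * s ! * suc n + suc n * (a * (Y * s !))     ≡⟨ cong₂ (λ x y → x + suc n * y) (insertion s k≡ n≡) (conversion a k≡ n≡) ⟩
  s * k ! * (2 + a) + suc n * (a * k !)         ≡⟨ cong (λ m → s * k ! * (2 + a) + suc m * (a * k !)) n≡ ⟨
  s * k ! * (2 + a) + suc (a + s) * (a * k !)   ≡⟨ collect s a (k !) ⟩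
  (a + s + s) * k ! * suc a                     ≡⟨ cong (λ m → m * k ! * suc a) k≡ ⟩
  suc k * k ! * suc a                           ∎
  where
  X = completions k (atShape 0 n) (suc a) 0
  Y = completions k (atShape 0 n) (pred a) 1
  distribute : ∀ x y a f m → (1 * x + a * y) * f * m ≡ x * f * m + m * (a * (y * f))
  distribute = solve-∀
  collect : ∀ s a f → s * f * (2 + a) + suc (a + s) * (a * f) ≡ (a + s + s) * f * suc a
  collect = solve-∀
  insertion : ∀ s → a + s + s ≡ suc k → a + s ≡ n → X * s ! * suc n ≡ s * k ! * (2 + a)
  insertion zero    _  n≡ = cong (λ x → x * 1 * suc n)
    (toAllTwos-unreachable n k (suc a) 0 (s≤s (≤-reflexive (sym n≡))))
  insertion (suc s) k≡ n≡ = begin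
    X * (suc s * s !) * suc n   ≡⟨ cong (_* suc n) (x∙yz≈y∙xz X (suc s) (s !)) ⟩
    suc s * (X * s !) * suc n   ≡⟨ *-assoc (suc s) (X * s !) (suc n) ⟩
    suc s * (X * s ! * suc n)   ≡⟨ cong (suc s *_) (toAllTwos-allOnes n k (suc a) s k≡′ n≡′) ⟩
    suc s * (k ! * (2 + a))     ≡⟨ *-assoc (suc s) (k !) (2 + a) ⟨
    suc s * k ! * (2 + a)       ∎
    where
    k≡′ : suc a + s + s ≡ k
    k≡′ = suc-injective (trans (sym (m+[1+n]+[1+n]≡2+m+n+n a s)) k≡)
    n≡′ : suc a + s ≡ n
    n≡′ = trans (sym (+-suc a s)) n≡
  conversion : ∀ a → a + s + s ≡ suc k → a + s ≡ n →
    a * (completions k (atShape 0 n) (pred a) 1 * s !) ≡ a * k !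
  conversion zero    _  _  = refl
  conversion (suc a) k≡ n≡ =
    cong (suc a *_) (toAllTwos-withTwo n k a 0 s (suc-injective k≡) (trans (cong (_+ s) (+-comm a 1)) n≡))

c2-0-closed : ∀ n → c2 0 n * suc n ! ≡ (2 * n) !
c2-0-closed n = begin
  c2 0 n * (suc n * n !)      ≡⟨ cong (_* (suc n * n !)) (c2≡completions 0 n) ⟩
  C * (suc n * n !)           ≡⟨ x∙yz≈y∙xz C (suc n) (n !) ⟩
  suc n * (C * n !)           ≡⟨ *-comm (suc n) (C * n !) ⟩
  C * n ! * suc n             ≡⟨ toAllTwos-allOnes n (2 * n) 0 n (cong (n +_) (sym (+-identityʳ n))) refl ⟩
  (2 * n) ! * 1               ≡⟨ *-identityʳ ((2 * n) !) ⟩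
  (2 * n) !                   ∎
  where
  C = completions (2 * n) (atShape 0 n) 0 0

c2-0-suc≡completions : ∀ n → c2 0 (suc n) ≡ completions (2 + 2 * n) (atShape 0 (suc n)) 0 0
c2-0-suc≡completions n = trans (c2≡completions 0 (suc n)) (cong (λ k → completions k (atShape 0 (suc n)) 0 0) (*-suc 2 n))

c2-1≡c2-0 : ∀ n → c2 1 n ≡ c2 0 (suc n)
c2-1≡c2-0 n = begin
  c2 1 n                                                   ≡⟨ c2≡completions 1 n ⟩
  completions (1 + 2 * n) (atShape 1 n) 0 0                ≡⟨ completions-cong (λ a b → sym (extend-atShape-0 n a b)) (1 + 2 * n) 0 0 ⟩
  completions (1 + 2 * n) (extend (atShape 0 (suc n))) 0 0 ≡⟨ completions-extend (1 + 2 * n) _ 0 0 ⟨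
  completions (2 + 2 * n) (atShape 0 (suc n)) 0 0          ≡⟨ c2-0-suc≡completions n ⟨
  c2 0 (suc n)                                             ∎

c2-1-suc : ∀ n → c2 1 (suc n) ≡ 2 * c2 0 (suc n) + 2 * c2 2 n
c2-1-suc n = begin
  c2 1 (suc n)
    ≡⟨ c2≡completions 1 (suc n) ⟩
  completions (1 + 2 * suc n) (atShape 1 (suc n)) 0 0
    ≡⟨ cong (λ k → completions (suc k) (atShape 1 (suc n)) 0 0) (*-suc 2 n) ⟩
  completions (3 + 2 * n) (atShape 1 (suc n)) 0 0
    ≡⟨ completions-extend (2 + 2 * n) _ 0 0 ⟩
  completions (2 + 2 * n) (extend (atShape 1 (suc n))) 0 0
    ≡⟨ completions-cong (extend-atShape-1 n) (2 + 2 * n) 0 0 ⟩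
  completions (2 + 2 * n) (λ a b → 2 * atShape 0 (suc n) a b + 2 * atShape 2 n a b) 0 0
    ≡⟨ completions-linear 2 2 _ _ (2 + 2 * n) 0 0 ⟩
  2 * completions (2 + 2 * n) (atShape 0 (suc n)) 0 0 + 2 * completions (2 + 2 * n) (atShape 2 n) 0 0
    ≡⟨ cong₂ (λ x y → 2 * x + 2 * y) (c2-0-suc≡completions n) (c2≡completions 2 n) ⟨
  2 * c2 0 (suc n) + 2 * c2 2 n
    ∎

c2-2-recurrence : ∀ n → 2 * c2 2 n + 2 * c2 0 (suc n) ≡ c2 0 (2 + n)
c2-2-recurrence n = begin
  2 * c2 2 n + 2 * c2 0 (suc n) ≡⟨ +-comm (2 * c2 2 n) _ ⟩
  2 * c2 0 (suc n) + 2 * c2 2 n ≡⟨ c2-1-suc n ⟨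
  c2 1 (suc n)                  ≡⟨ c2-1≡c2-0 (suc n) ⟩
  c2 0 (2 + n)                  ∎

c2-2-closed : ∀ n → c2 2 n * (3 + n) ! ≡ (2 * n * n + 6 * n + 3) * (2 * suc n) !
c2-2-closed n = *-cancelˡ-≡ _ _ 2 (+-cancelʳ-≡ (2 * (A * T)) _ _ (begin
  2 * (X * T) + 2 * (A * T)                     ≡⟨ factor X A T ⟩
  (2 * X + 2 * A) * T                           ≡⟨ cong (_* T) (c2-2-recurrence n) ⟩
  c2 0 (2 + n) * T                              ≡⟨ c2-0-closed (2 + n) ⟩
  (2 * (2 + n)) !                               ≡⟨ cong _! (*-suc 2 (suc n)) ⟩
  (2 + 2 * suc n) !                             ≡⟨ expand n F ⟩
  2 * (p * F) + 2 * ((3 + n) * F)               ≡⟨ cong (λ x → 2 * (p * F) + 2 * ((3 + n) * x)) (c2-0-closed (suc n)) ⟨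
  2 * (p * F) + 2 * ((3 + n) * (A * (2 + n) !)) ≡⟨ cong (λ x → 2 * (p * F) + 2 * x) (x∙yz≈y∙xz (3 + n) A ((2 + n) !)) ⟩
  2 * (p * F) + 2 * (A * T)                     ∎))
  where
  X = c2 2 n
  A = c2 0 (suc n)
  T = (3 + n) !
  F = (2 * suc n) !
  p = 2 * n * n + 6 * n + 3
  factor : ∀ x a t → 2 * (x * t) + 2 * (a * t) ≡ (2 * x + 2 * a) * t
  factor = solve-∀
  expand : ∀ n F → (2 + 2 * suc n) * ((1 + 2 * suc n) * F) ≡ 2 * ((2 * n * n + 6 * n + 3) * F) + 2 * ((3 + n) * F)
  expand = solve-∀

mainTheorem6 : ∀ (n : ℕ) →
      (c2 0 n * (n + 1) ! ≡ (2 * n) !)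
    × (c2 1 n ≡ c2 0 (n + 1))
    × (c2 1 n * (n + 2) ! ≡ (2 * (n + 1)) !)
    × (2 * c2 2 n + 2 * c2 0 (n + 1) ≡ c2 0 (n + 2))
    × (c2 2 n * (n + 3) ! ≡ (2 * n * n + 6 * n + 3) * (2 * (n + 1)) !)
mainTheorem6 n rewrite +-comm n 1 | +-comm n 2 | +-comm n 3 =
    c2-0-closed n
  , c2-1≡c2-0 n
  , trans (cong (_* (2 + n) !) (c2-1≡c2-0 n)) (c2-0-closed (suc n))
  , c2-2-recurrence n
  , c2-2-closed n
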